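{- Let $n\ge 1$. Every bijective automata network $F:\{0,1\}^n\to\{0,1\}^n$ of degree at most $2$ is affine over $\mathrm{GF}(2)$, i.e. there exist a matrix $A\in\mathrm{GF}(2)^{n\times n}$ and a vector $v\in\mathrm{GF}(2)^n$ with $F(x)=Ax+v$ for all $x$.
   Context: An automata network is a map $F:\{0,1\}^V\to\{0,1\}^V$, $V=\{1,\dots,n\}$, with local functions $f_j(x)=F(x)_j$. Its interaction graph has an arc $(i,j)$ iff $f_j$ effectively depends on $x_i$ (there exist $x,x'$ differing only at $i$ with $f_j(x)\neq f_j(x')$). The degree of $F$ is the maximum in-degree of its interaction graph. -}

module Defs where

open import Data.Nat using (ℕ; _≤_)
open import Data.Bool using (Bool; true; false; not; _∧_; _xor_)
open import Data.Fin using (Fin)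
open import Data.Vec using (Vec; lookup; tabulate; updateAt; foldr; map; zipWith)
open import Data.List using (List; length)
open import Data.List.Membership.Propositional using (_∈_)
open import Data.Product using (Σ; ∃; _×_)
open import Relation.Binary.PropositionalEquality using (_≡_; _≢_)

-- Configurations {0,1}^n, with 0/1 encoded as false/true (= GF(2)).
Config : ℕ → Set
Config n = Vec Bool n

AN : ℕ → Set
AN n = Config n → Config n

local : ∀ {n} → AN n → Fin n → Config n → Bool
local F j x = lookup (F x) j

flipAt : ∀ {n} → Fin n → Config n → Config n
flipAt i x = updateAt x i not

-- Arc (i , j) in the interaction graph: f_j effectively depends on x_i.
Arc : ∀ {n} → AN n → Fin n → Fin n → Set
Arc F i j = ∃ λ x → local F j x ≢ local F j (flipAt i x)

InDegree≤ : ∀ {n} → AN n → ℕ → Fin n → Set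
InDegree≤ {n} F k j =
  Σ (List (Fin n)) λ S → (length S ≤ k) × (∀ i → Arc F i j → i ∈ S)

Degree≤ : ∀ {n} → AN n → ℕ → Set
Degree≤ F k = ∀ j → InDegree≤ F k j

Bijective : ∀ {n} → AN n → Set
Bijective {n} F =
  (∀ x y → F x ≡ F y → x ≡ y) × (∀ y → ∃ λ x → F x ≡ y)

-- Linear algebra over GF(2) = (Bool, xor, ∧).
Matrix : ℕ → Set
Matrix n = Vec (Vec Bool n) n

dot : ∀ {n} → Vec Bool n → Vec Bool n → Bool
dot a x = foldr (λ _ → Bool) _xor_ false (zipWith _∧_ a x)

mulVec : ∀ {n} → Matrix n → Vec Bool n → Vec Bool n
mulVec A x = map (λ row → dot row x) A

affineMap : ∀ {n} → Matrix n → Vec Bool n → Config n → Config n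
affineMap A v x = zipWith _xor_ (mulVec A x) v

IsAffine : ∀ {n} → AN n → Set
IsAffine {n} F = Σ (Matrix n) λ A → Σ (Vec Bool n) λ v → ∀ x → F x ≡ affineMap A v x

-- Bijectivity makes every local function f = f_j balanced, and so is f composed
-- with any coordinate flip.  Suppose ∂ᵢ f x := f x xor f (x + eᵢ) changed under
-- the flip of m.  Then f depends on both i and m, so (degree ≤ 2) on no other
-- coordinate, and the number W x of ones among f on the square x, x+eᵢ, x+eₘ,
-- x+eᵢ+eₘ is invariant under every flip, hence constant; summing over all x and
-- using balancedness gives W ≡ 2.  An even number of ones on the square forces
-- ∂ᵢ f x = ∂ᵢ f (x + eₘ), a contradiction.  So every ∂ᵢ f is constant, which
-- makes f affine.
module Submission where

open import Defs
open import Data.Nat using (ℕ; zero; suc; _+_; _*_; _^_; _≤_; _≥_; s≤s)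
open import Data.Nat.Properties using (+-comm; *-suc; *-zeroʳ; *-identityˡ; *-cancelʳ-≡; m^n≢0; +-commutativeSemigroup)
open import Algebra.Properties.CommutativeSemigroup +-commutativeSemigroup using (interchange)
open import Data.Bool using (Bool; true; false; not; _∧_; _xor_)
open import Data.Bool.Properties using (xor-same; xor-comm; xor-assoc; ∧-zeroʳ; ∧-identityʳ)
import Data.Bool.Properties as Bool
open import Data.Fin using (Fin; zero; suc)
import Data.Fin.Properties as Fin
open import Data.Vec using (Vec; []; _∷_; lookup; replicate; tabulate)
open import Data.Vec.Properties using (updateAt-updateAt-local; updateAt-id; lookup∘updateAt; lookup-zipWith; lookup-map; lookup∘tabulate; tabulate∘lookup; tabulate-cong)
open import Data.List using (List; []; _∷_; _++_; map; length)
open import Data.List.Properties using (map-∘; map-cong; length-++; length-map)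
open import Data.Nat.ListAction using (sum)
open import Data.Nat.ListAction.Properties using (sum-↭)
open import Data.List.Membership.Propositional using (_∈_)
open import Data.List.Membership.Propositional.Properties using (∈-map⁺; ∈-map⁻; ∈-++⁺ˡ; ∈-++⁺ʳ)
open import Data.List.Membership.Propositional.Properties.WithK using (unique∧set⇒bag)
open import Data.List.Relation.Unary.Any using (here; there)
open import Data.List.Relation.Unary.Unique.Propositional using (Unique)
open import Data.List.Relation.Unary.AllPairs using ([]; _∷_)
open import Data.List.Relation.Unary.All using ([])
import Data.List.Relation.Unary.Unique.Propositional.Properties as Unique
open import Data.List.Relation.Binary.BagAndSetEquality using (∼bag⇒↭)
open import Data.List.Relation.Binary.Permutation.Propositional using (_↭_)
import Data.List.Relation.Binary.Permutation.Propositional.Properties as ↭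
open import Data.Product using (∃; _×_; _,_; proj₁; proj₂)
open import Data.Sum using (_⊎_; inj₁; inj₂)
open import Data.Empty using (⊥; ⊥-elim)
open import Function using (_∘_; mk⇔)
open import Relation.Nullary using (¬_; yes; no)
open import Relation.Binary.PropositionalEquality

private
  variable
    n : ℕ

0ᶜ : Config n
0ᶜ = replicate _ false

toℕ : Bool → ℕ
toℕ false = 0
toℕ true  = 1

xor-cancelˡ : ∀ a b c → a xor b ≡ c → b ≡ a xor c
xor-cancelˡ a b c refl = begin
  b                  ≡⟨⟩
  false xor b        ≡⟨ cong (_xor b) (sym (xor-same a)) ⟩
  (a xor a) xor b    ≡⟨ xor-assoc a a b ⟩
  a xor (a xor b)    ∎
  where open ≡-Reasoning

xor≢xor⇒≢ˡ⊎≢ʳ : ∀ {a b c d} → a xor b ≢ c xor d → a ≢ c ⊎ b ≢ d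
xor≢xor⇒≢ˡ⊎≢ʳ {a} {b} {c} {d} ne with a Bool.≟ c | b Bool.≟ d
... | no a≢c   | _        = inj₁ a≢c
... | yes _    | no b≢d   = inj₂ b≢d
... | yes refl | yes refl = ⊥-elim (ne refl)

xor≢xor⇒≢₁⊎≢₂ : ∀ {a b c d} → a xor b ≢ c xor d → a ≢ b ⊎ c ≢ d
xor≢xor⇒≢₁⊎≢₂ {a} {b} {c} {d} ne with a Bool.≟ b | c Bool.≟ d
... | no a≢b   | _        = inj₁ a≢b
... | yes _    | no c≢d   = inj₂ c≢d
... | yes refl | yes refl = ⊥-elim (ne (trans (xor-same a) (sym (xor-same c))))

even-square⇒xor≡xor : ∀ a b c d → toℕ a + toℕ b + (toℕ c + toℕ d) ≡ 2 → a xor b ≡ c xor d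
even-square⇒xor≡xor false false false false ()
even-square⇒xor≡xor false false false true  ()
even-square⇒xor≡xor false false true  false ()
even-square⇒xor≡xor false false true  true  _ = refl
even-square⇒xor≡xor false true  false false ()
even-square⇒xor≡xor false true  false true  _ = refl
even-square⇒xor≡xor false true  true  false _ = refl
even-square⇒xor≡xor false true  true  true  ()
even-square⇒xor≡xor true  false false false ()
even-square⇒xor≡xor true  false false true  _ = refl
even-square⇒xor≡xor true  false true  false _ = refl
even-square⇒xor≡xor true  false true  true  ()
even-square⇒xor≡xor true  true  false false _ = refl
even-square⇒xor≡xor true  true  false true  ()
even-square⇒xor≡xor true  true  true  false ()
even-square⇒xor≡xor true  true  true  true  ()

flipAt-involutive : (i : Fin n) (x : Config n) → flipAt i (flipAt i x) ≡ x
flipAt-involutive i x =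
  trans (updateAt-updateAt-local i x (Bool.not-involutive (lookup x i))) (updateAt-id i x)

flipAt-comm : (i k : Fin n) (x : Config n) → flipAt i (flipAt k x) ≡ flipAt k (flipAt i x)
flipAt-comm zero    zero    x       = refl
flipAt-comm zero    (suc k) (b ∷ x) = refl
flipAt-comm (suc i) zero    (b ∷ x) = refl
flipAt-comm (suc i) (suc k) (b ∷ x) = cong (b ∷_) (flipAt-comm i k x)

flipAt-bijective : (i : Fin n) → Bijective (flipAt i)
flipAt-bijective i =
    (λ x y eq → trans (sym (flipAt-involutive i x))
                      (trans (cong (flipAt i) eq) (flipAt-involutive i y)))
  , (λ y → flipAt i y , flipAt-involutive i y)

flip-invariant⇒constant : {A : Set} (h : Config n → A) →
                          (∀ k x → h (flipAt k x) ≡ h x) → ∀ x → h x ≡ h 0ᶜ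
flip-invariant⇒constant {zero}  h inv []          = refl
flip-invariant⇒constant {suc n} h inv (false ∷ x) =
  flip-invariant⇒constant (h ∘ (false ∷_)) (λ k y → inv (suc k) (false ∷ y)) x
flip-invariant⇒constant {suc n} h inv (true ∷ x)  =
  trans (inv zero (false ∷ x))
        (flip-invariant⇒constant (h ∘ (false ∷_)) (λ k y → inv (suc k) (false ∷ y)) x)

configs : (n : ℕ) → List (Config n)
configs zero    = [] ∷ []
configs (suc n) = map (false ∷_) (configs n) ++ map (true ∷_) (configs n)

∈-configs : (x : Config n) → x ∈ configs n
∈-configs          []          = here refl
∈-configs          (false ∷ x) = ∈-++⁺ˡ (∈-map⁺ (false ∷_) (∈-configs x))
∈-configs {suc n}  (true ∷ x)  = ∈-++⁺ʳ (map (false ∷_) (configs n)) (∈-map⁺ (true ∷_) (∈-configs x))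

configs-unique : (n : ℕ) → Unique (configs n)
configs-unique zero    = [] ∷ []
configs-unique (suc n) =
  Unique.++⁺ (Unique.map⁺ ∷-injectiveʳ (configs-unique n))
             (Unique.map⁺ ∷-injectiveʳ (configs-unique n))
             disjoint
  where
  ∷-injectiveʳ : ∀ {b} {x y : Config n} → Vec._∷_ b x ≡ b ∷ y → x ≡ y
  ∷-injectiveʳ refl = refl
  disjoint : ∀ {x} → ¬ (x ∈ map (false ∷_) (configs n) × x ∈ map (true ∷_) (configs n))
  disjoint (p , q) with ∈-map⁻ (false ∷_) p | ∈-map⁻ (true ∷_) q
  ... | _ , _ , refl | _ , _ , ()

length-configs : (n : ℕ) → length (configs n) ≡ 2 ^ n
length-configs zero    = refl
length-configs (suc n) = begin
  length (map (false ∷_) (configs n) ++ map (true ∷_) (configs n))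
    ≡⟨ length-++ (map (false ∷_) (configs n)) ⟩
  length (map (false ∷_) (configs n)) + length (map (true ∷_) (configs n))
    ≡⟨ cong₂ _+_ (length-map _ (configs n)) (length-map _ (configs n)) ⟩
  length (configs n) + length (configs n)
    ≡⟨ cong₂ _+_ (length-configs n) (trans (length-configs n) (sym (+-comm (2 ^ n) 0))) ⟩
  2 ^ n + (2 ^ n + 0)
    ∎
  where open ≡-Reasoning

map-configs-↭ : (G : AN n) → Bijective G → map G (configs n) ↭ configs n
map-configs-↭ {n} G (injective , surjective) =
  ∼bag⇒↭ (unique∧set⇒bag (Unique.map⁺ (injective _ _) (configs-unique n)) (configs-unique n)
                         (λ {y} → mk⇔ (λ _ → ∈-configs y) (λ _ → hit (surjective y))))
  where
  hit : ∀ {y} → ∃ (λ x → G x ≡ y) → y ∈ map G (configs n)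
  hit (x , refl) = ∈-map⁺ G (∈-configs x)

sum-map-+ : {A : Set} (h k : A → ℕ) (xs : List A) →
            sum (map (λ x → h x + k x) xs) ≡ sum (map h xs) + sum (map k xs)
sum-map-+ h k []       = refl
sum-map-+ h k (x ∷ xs) = trans (cong (h x + k x +_) (sum-map-+ h k xs))
                               (interchange (h x) (k x) _ _)

sum-map-const : {A : Set} (c : ℕ) (xs : List A) → sum (map (λ _ → c) xs) ≡ c * length xs
sum-map-const c []       = sym (*-zeroʳ c)
sum-map-const c (x ∷ xs) = trans (cong (c +_) (sum-map-const c xs)) (sym (*-suc c (length xs)))

total : (Config n → ℕ) → ℕ
total {n} h = sum (map h (configs n))

total-cong : {h k : Config n → ℕ} → (∀ x → h x ≡ k x) → total h ≡ total k
total-cong {n} eq = cong sum (map-cong eq (configs n))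

total-+ : (h k : Config n → ℕ) → total (λ x → h x + k x) ≡ total h + total k
total-+ {n} h k = sum-map-+ h k (configs n)

total-const : (c : ℕ) → total {n} (λ _ → c) ≡ c * 2 ^ n
total-const {n} c = trans (sum-map-const c (configs n)) (cong (c *_) (length-configs n))

total-∘-bijective : (G : AN n) → Bijective G → (h : Config n → ℕ) → total (h ∘ G) ≡ total h
total-∘-bijective {n} G bij h =
  trans (cong sum (map-∘ (configs n))) (sum-↭ (↭.map⁺ h (map-configs-↭ G bij)))

Balanced : (Config n → Bool) → Set
Balanced {n} f = total (toℕ ∘ f) + total (toℕ ∘ f) ≡ 2 ^ n

balanced-∘-bijective : {f : Config n → Bool} (G : AN n) → Bijective G → Balanced f → Balanced (f ∘ G)
balanced-∘-bijective {f = f} G bij =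
  subst (λ t → t + t ≡ _) (sym (total-∘-bijective G bij (toℕ ∘ f)))

lookup-balanced : (j : Fin n) → Balanced (λ (y : Config n) → lookup y j)
lookup-balanced {n} j = begin
  total bit + total bit
    ≡⟨ cong (total bit +_) (sym (total-∘-bijective (flipAt j) (flipAt-bijective j) bit)) ⟩
  total bit + total (bit ∘ flipAt j)
    ≡⟨ cong (total bit +_) (total-cong (λ y → cong toℕ (lookup∘updateAt j y))) ⟩
  total bit + total (toℕ ∘ not ∘ (λ y → lookup y j))
    ≡⟨ sym (total-+ bit (toℕ ∘ not ∘ (λ y → lookup y j))) ⟩
  total (λ y → toℕ (lookup y j) + toℕ (not (lookup y j)))
    ≡⟨ total-cong (λ y → bit+not-bit (lookup y j)) ⟩
  total {n} (λ _ → 1)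
    ≡⟨ trans (total-const {n} 1) (*-identityˡ (2 ^ n)) ⟩
  2 ^ n
    ∎
  where
  open ≡-Reasoning
  bit : Config n → ℕ
  bit y = toℕ (lookup y j)
  bit+not-bit : ∀ b → toℕ b + toℕ (not b) ≡ 1
  bit+not-bit false = refl
  bit+not-bit true  = refl

local-balanced : (F : AN n) → Bijective F → (j : Fin n) → Balanced (local F j)
local-balanced F bij j = balanced-∘-bijective F bij (lookup-balanced j)

∂ : Fin n → (Config n → Bool) → Config n → Bool
∂ i f x = f x xor f (flipAt i x)

constant-∂⇒affine : (f : Config n → Bool) (c : Vec Bool n) →
                    (∀ i x → ∂ i f x ≡ lookup c i) → ∀ x → f x ≡ dot c x xor f 0ᶜ
constant-∂⇒affine f [] ∂f≡c [] = refl
constant-∂⇒affine f (c₀ ∷ c) ∂f≡c (false ∷ x) = begin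
  f (false ∷ x)                      ≡⟨ constant-∂⇒affine (f ∘ (false ∷_)) c (λ i y → ∂f≡c (suc i) (false ∷ y)) x ⟩
  dot c x xor f 0ᶜ                   ≡⟨ cong (λ b → (b xor dot c x) xor f 0ᶜ) (sym (∧-zeroʳ c₀)) ⟩
  ((c₀ ∧ false) xor dot c x) xor f 0ᶜ  ∎
  where open ≡-Reasoning
constant-∂⇒affine f (c₀ ∷ c) ∂f≡c (true ∷ x) = begin
  f (true ∷ x)                       ≡⟨ xor-cancelˡ (f (false ∷ x)) _ c₀ (∂f≡c zero (false ∷ x)) ⟩
  f (false ∷ x) xor c₀               ≡⟨ cong (_xor c₀) (constant-∂⇒affine (f ∘ (false ∷_)) c (λ i y → ∂f≡c (suc i) (false ∷ y)) x) ⟩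
  (dot c x xor f 0ᶜ) xor c₀          ≡⟨ xor-comm _ c₀ ⟩
  c₀ xor (dot c x xor f 0ᶜ)          ≡⟨ sym (xor-assoc c₀ (dot c x) (f 0ᶜ)) ⟩
  (c₀ xor dot c x) xor f 0ᶜ          ≡⟨ cong (λ b → (b xor dot c x) xor f 0ᶜ) (sym (∧-identityʳ c₀)) ⟩
  ((c₀ ∧ true) xor dot c x) xor f 0ᶜ ∎
  where open ≡-Reasoning

module Square {n} (f : Config n → Bool) (balanced : Balanced f) (i m : Fin n)
              (frozen : ∀ k → k ≢ i → k ≢ m → ∀ x → f (flipAt k x) ≡ f x) where

  P : Config n → ℕ
  P z = toℕ (f z) + toℕ (f (flipAt i z))

  W : Config n → ℕ
  W z = P z + P (flipAt m z)

  P-flipAt-i : ∀ z → P (flipAt i z) ≡ P z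
  P-flipAt-i z = trans (cong (λ y → toℕ (f (flipAt i z)) + toℕ (f y)) (flipAt-involutive i z))
                       (+-comm (toℕ (f (flipAt i z))) (toℕ (f z)))

  P-flipAt-frozen : ∀ k → k ≢ i → k ≢ m → ∀ z → P (flipAt k z) ≡ P z
  P-flipAt-frozen k k≢i k≢m z =
    cong₂ _+_ (cong toℕ (frozen k k≢i k≢m z))
              (cong toℕ (trans (cong f (flipAt-comm i k z)) (frozen k k≢i k≢m _)))

  W-flipAt : ∀ k z → W (flipAt k z) ≡ W z
  W-flipAt k z with k Fin.≟ i | k Fin.≟ m
  ... | yes refl | _ =
    cong₂ _+_ (P-flipAt-i z) (trans (cong P (flipAt-comm m k z)) (P-flipAt-i (flipAt m z)))
  ... | no _ | yes refl =
    trans (cong (P (flipAt k z) +_) (cong P (flipAt-involutive k z))) (+-comm (P (flipAt k z)) (P z))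
  ... | no k≢i | no k≢m =
    cong₂ _+_ (P-flipAt-frozen k k≢i k≢m z)
              (trans (cong P (flipAt-comm m k z)) (P-flipAt-frozen k k≢i k≢m (flipAt m z)))

  total-P : total P ≡ 2 ^ n
  total-P = trans (total-+ (toℕ ∘ f) (toℕ ∘ f ∘ flipAt i))
    (trans (cong (total (toℕ ∘ f) +_) (total-∘-bijective (flipAt i) (flipAt-bijective i) (toℕ ∘ f)))
           balanced)

  total-W : total W ≡ 2 * 2 ^ n
  total-W = begin
    total W                          ≡⟨ total-+ P (P ∘ flipAt m) ⟩
    total P + total (P ∘ flipAt m)   ≡⟨ cong (total P +_) (total-∘-bijective (flipAt m) (flipAt-bijective m) P) ⟩
    total P + total P                ≡⟨ cong₂ _+_ total-P (trans total-P (sym (+-comm (2 ^ n) 0))) ⟩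
    2 * 2 ^ n                        ∎
    where open ≡-Reasoning

  W≡2 : ∀ x → W x ≡ 2
  W≡2 x = trans (W-constant x) (*-cancelʳ-≡ (W 0ᶜ) 2 (2 ^ n) {{m^n≢0 2 n}} (begin
    W 0ᶜ * 2 ^ n              ≡⟨ sym (total-const {n} (W 0ᶜ)) ⟩
    total {n} (λ _ → W 0ᶜ)    ≡⟨ sym (total-cong {n} W-constant) ⟩
    total W                   ≡⟨ total-W ⟩
    2 * 2 ^ n                 ∎))
    where
    open ≡-Reasoning
    W-constant : ∀ x → W x ≡ W 0ᶜ
    W-constant = flip-invariant⇒constant W W-flipAt

  ∂-flipAt : ∀ x → ∂ i f (flipAt m x) ≡ ∂ i f x
  ∂-flipAt x = sym (even-square⇒xor≡xor (f x) (f (flipAt i x)) (f (flipAt m x)) (f (flipAt i (flipAt m x))) (W≡2 x))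

length≤2⇒¬distinct₃ : {A : Set} {S : List A} {i m k : A} → length S ≤ 2 →
                      i ∈ S → m ∈ S → k ∈ S → i ≢ m → k ≢ i → k ≢ m → ⊥
length≤2⇒¬distinct₃ {S = _ ∷ []}     _ (here refl) (here refl) _ i≢m _ _ = i≢m refl
length≤2⇒¬distinct₃ {S = _ ∷ _ ∷ []} _ (here refl) (here refl) _ i≢m _ _ = i≢m refl
length≤2⇒¬distinct₃ {S = _ ∷ _ ∷ []} _ (there (here refl)) (there (here refl)) _ i≢m _ _ = i≢m refl
length≤2⇒¬distinct₃ {S = _ ∷ _ ∷ []} _ (here refl) _ (here refl) _ k≢i _ = k≢i refl
length≤2⇒¬distinct₃ {S = _ ∷ _ ∷ []} _ (there (here refl)) _ (there (here refl)) _ k≢i _ = k≢i refl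
length≤2⇒¬distinct₃ {S = _ ∷ _ ∷ []} _ _ (here refl) (here refl) _ _ k≢m = k≢m refl
length≤2⇒¬distinct₃ {S = _ ∷ _ ∷ []} _ _ (there (here refl)) (there (here refl)) _ _ k≢m = k≢m refl
length≤2⇒¬distinct₃ {S = _ ∷ _ ∷ _ ∷ _} (s≤s (s≤s ())) _ _ _ _ _ _

¬Arc⇒flip-invariant : (F : AN n) {k j : Fin n} → ¬ Arc F k j → ∀ x → local F j (flipAt k x) ≡ local F j x
¬Arc⇒flip-invariant F {k} {j} ¬arc x with local F j (flipAt k x) Bool.≟ local F j x
... | yes eq = eq
... | no neq = ⊥-elim (¬arc (x , λ eq → neq (sym eq)))

module _ {n} (F : AN n) (bij : Bijective F) {j : Fin n} (deg : InDegree≤ F 2 j) where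

  private
    f : Config n → Bool
    f = local F j

  ∂-local-flip-invariant : ∀ i m x → ∂ i f (flipAt m x) ≡ ∂ i f x
  ∂-local-flip-invariant i m x with ∂ i f (flipAt m x) Bool.≟ ∂ i f x
  ... | yes eq = eq
  ... | no neq = ⊥-elim (neq (Square.∂-flipAt f (local-balanced F bij j) i m frozen x))
    where
    arc⇒∈S : ∀ {k} → Arc F k j → k ∈ proj₁ deg
    arc⇒∈S = proj₂ (proj₂ deg) _

    arc-i : Arc F i j
    arc-i with xor≢xor⇒≢₁⊎≢₂ neq
    ... | inj₁ ne = flipAt m x , ne
    ... | inj₂ ne = x , ne

    arc-m : Arc F m j
    arc-m with xor≢xor⇒≢ˡ⊎≢ʳ neq
    ... | inj₁ ne = x , λ eq → ne (sym eq)
    ... | inj₂ ne = flipAt i x , λ eq → ne (trans (cong f (flipAt-comm i m x)) (sym eq))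

    i≢m : i ≢ m
    i≢m refl = neq (trans (cong (λ y → f (flipAt i x) xor f y) (flipAt-involutive i x))
                          (xor-comm (f (flipAt i x)) (f x)))

    frozen : ∀ k → k ≢ i → k ≢ m → ∀ y → f (flipAt k y) ≡ f y
    frozen k k≢i k≢m = ¬Arc⇒flip-invariant F λ arc-k →
      length≤2⇒¬distinct₃ (proj₁ (proj₂ deg)) (arc⇒∈S arc-i) (arc⇒∈S arc-m) (arc⇒∈S arc-k) i≢m k≢i k≢m

  gradient : Vec Bool n
  gradient = tabulate (λ i → ∂ i f 0ᶜ)

  local-affine : ∀ x → f x ≡ dot gradient x xor f 0ᶜ
  local-affine = constant-∂⇒affine f gradient λ i x →
    trans (flip-invariant⇒constant (∂ i f) (∂-local-flip-invariant i) x)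
          (sym (lookup∘tabulate _ i))

lookup-affineMap : (A : Matrix n) (v x : Vec Bool n) (j : Fin n) →
                   lookup (affineMap A v x) j ≡ dot (lookup A j) x xor lookup v j
lookup-affineMap A v x j =
  trans (lookup-zipWith _xor_ j (mulVec A x) v) (cong (_xor lookup v j) (lookup-map j (λ r → dot r x) A))

corollary1 : (n : ℕ) → n ≥ 1 → (F : AN n) → Bijective F → Degree≤ F 2 → IsAffine F
corollary1 n _ F bij deg = A , v , λ x → begin
  F x                                  ≡⟨ sym (tabulate∘lookup (F x)) ⟩
  tabulate (lookup (F x))              ≡⟨ tabulate-cong (λ j → local-affine-row j x) ⟩
  tabulate (lookup (affineMap A v x))  ≡⟨ tabulate∘lookup _ ⟩
  affineMap A v x                      ∎
  where
  open ≡-Reasoning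
  A : Matrix n
  A = tabulate (λ j → gradient F bij (deg j))
  v : Vec Bool n
  v = F 0ᶜ
  local-affine-row : ∀ j x → lookup (F x) j ≡ lookup (affineMap A v x) j
  local-affine-row j x = begin
    local F j x                          ≡⟨ local-affine F bij (deg j) x ⟩
    dot (gradient F bij (deg j)) x xor local F j 0ᶜ
                                         ≡⟨ cong (λ r → dot r x xor lookup v j) (sym (lookup∘tabulate _ j)) ⟩
    dot (lookup A j) x xor lookup v j    ≡⟨ sym (lookup-affineMap A v x j) ⟩
    lookup (affineMap A v x) j           ∎
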